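{- Let $i,j,\ell,n\in\mathbb{N}$ with $\ell$ odd, $i<j$ and $(j+1)\ell\le n$. Let $I_i=\{i\ell+1,\dots,(i+1)\ell\}$, $I_j=\{j\ell+1,\dots,(j+1)\ell\}$ and $C_{ij}=\{(j-i)\ell-\lfloor\ell/2\rfloor,\dots,(j-i)\ell+\lfloor\ell/2\rfloor\}$. Then there exists a rainbow perfect matching in $K_{[n]}$ between $I_i$ and $I_j$ (every edge has one endpoint in $I_i$ and one in $I_j$, and every vertex of $I_i\cup I_j$ is covered) all of whose edges have colours in $C_{ij}$.
   Context: $[n]=\{1,\dots,n\}$; $K_{[n]}$ is the complete graph on $[n]$ with edge $ab$ coloured $|a-b|$. A matching is rainbow if its edges have pairwise distinct colours. -}

module Defs where

open import Data.Nat using (ℕ; suc; _+_; _*_; _∸_; _≤_; _/_; ∣_-_∣)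
open import Data.Product using (_×_; _,_; ∃)
open import Data.Sum using (_⊎_)
open import Data.List using (List; map; concatMap; _∷_; [])
open import Data.List.Relation.Unary.All using (All)
open import Data.List.Relation.Unary.Unique.Propositional using (Unique)
open import Data.List.Membership.Propositional using (_∈_)
open import Relation.Binary.PropositionalEquality using (_≢_)

_∈[_,_] : ℕ → ℕ → ℕ → Set
v ∈[ lo , hi ] = lo ≤ v × v ≤ hi

-- vertices of K_[n] are 1..n ; an edge is an (unordered) pair of distinct vertices,
-- represented by a pair (a , b)
Edge : Set
Edge = ℕ × ℕ

colour : Edge → ℕ
colour (a , b) = ∣ a - b ∣

IsEdgeOf : ℕ → Edge → Set
IsEdgeOf n (a , b) = a ∈[ 1 , n ] × b ∈[ 1 , n ] × a ≢ b

endpoints : List Edge → List ℕ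
endpoints = concatMap (λ { (a , b) → a ∷ b ∷ [] })

-- a matching in K_[n]: a list of edges of K_[n], pairwise vertex-disjoint
-- (no vertex occurs twice among all endpoints; in particular no repeated edge)
IsMatching : ℕ → List Edge → Set
IsMatching n M = All (IsEdgeOf n) M × Unique (endpoints M)

Rainbow : List Edge → Set
Rainbow M = Unique (map colour M)

_∈I[_,_] : ℕ → ℕ → ℕ → Set
v ∈I[ k , ℓ ] = v ∈[ k * ℓ + 1 , suc k * ℓ ]

_∈C[_,_,_] : ℕ → ℕ → ℕ → ℕ → Set
c ∈C[ i , j , ℓ ] = c ∈[ (j ∸ i) * ℓ ∸ ℓ / 2 , (j ∸ i) * ℓ + ℓ / 2 ]

Between : ℕ → ℕ → ℕ → Edge → Set
Between i j ℓ (a , b) = (a ∈I[ i , ℓ ] × b ∈I[ j , ℓ ]) ⊎ (a ∈I[ j , ℓ ] × b ∈I[ i , ℓ ])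

RainbowPerfectMatchingBetween : ℕ → ℕ → ℕ → ℕ → List Edge → Set
RainbowPerfectMatchingBetween n i j ℓ M =
  IsMatching n M × Rainbow M ×
  All (Between i j ℓ) M ×
  (∀ v → (v ∈I[ i , ℓ ] ⊎ v ∈I[ j , ℓ ]) → v ∈ endpoints M) ×
  All (λ e → colour e ∈C[ i , j , ℓ ]) M

{-# OPTIONS --safe #-}
-- Write ℓ = 2m + 1 and let A and B be the first vertices of I_i and I_j, so B − A = (j − i)ℓ.
-- Join A + x to B + (2x mod ℓ) for 0 ≤ x ≤ 2m. Doubling permutes the residues modulo the odd
-- number ℓ, so this is a perfect matching between I_i and I_j; the edge at A + x has colour
-- (j − i)ℓ + r, where r ∈ [−m, m] is the residue of x, so the colours are distinct and lie in C_ij.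
-- Concretely the matching is the staircase of edges (A + k, B + 2k) for k ≤ m, with colours
-- (j − i)ℓ + k, followed by (A + m + 1 + k, B + 2k + 1) for k < m, with colours (j − i)ℓ − m + k.

module Submission where

open import Defs
open import Algebra.Properties.CommutativeSemigroup using (xy∙z≈xz∙y)
open import Data.Nat using (ℕ; suc; _+_; _*_; _∸_; _/_; _%_; _<_; _≤_; _≤?_; s≤s; s≤s⁻¹; s<s; z<s; ∣_-_∣)
open import Data.Nat.Properties
open import Data.Nat.DivMod using (m≡m%n+[m/n]*n; m%n<n; m/n≤m)
open import Data.Nat.Tactic.RingSolver using (solve-∀)
open import Data.Product using (∃; _×_; _,_; proj₁; proj₂)
open import Data.Sum using (_⊎_; inj₁; inj₂)
open import Data.List using (List; _∷_; _++_; applyUpTo)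
open import Data.List.Membership.Propositional using (_∈_)
open import Data.List.Membership.Propositional.Properties using (∈-++⁺ˡ; ∈-++⁺ʳ; ∈-applyUpTo⁺)
open import Data.List.Relation.Unary.All as All using (All; []; _∷_)
import Data.List.Relation.Unary.All.Properties as All
open import Data.List.Relation.Unary.AllPairs as AllPairs using (AllPairs; []; _∷_)
import Data.List.Relation.Unary.AllPairs.Properties as AllPairs
open import Data.List.Relation.Unary.Any using (here; there)
open import Data.List.Relation.Unary.Unique.Propositional using (Unique)
open import Function using (_∘_; id)
open import Level using (0ℓ)
open import Relation.Binary.PropositionalEquality
  using (_≡_; _≢_; refl; sym; trans; cong; cong₂; subst; subst₂; ≢-sym; module ≡-Reasoning)
open import Relation.Nullary using (¬_; yes; no)
open import Relation.Unary using (Pred; _⊆_; _≐_; _∪_; _≬_)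

n%2≡1⇒n≡1+2*[n/2] : ∀ {n} → n % 2 ≡ 1 → n ≡ suc (2 * (n / 2))
n%2≡1⇒n≡1+2*[n/2] {n} n%2≡1 = trans (m≡m%n+[m/n]*n n 2) (cong₂ _+_ n%2≡1 (*-comm (n / 2) 2))

even-or-odd : ∀ n → ∃ λ h → n ≡ 2 * h ⊎ n ≡ suc (2 * h)
even-or-odd n with n % 2 | m≡m%n+[m/n]*n n 2 | m%n<n n 2
... | 0 | n≡ | _ = n / 2 , inj₁ (trans n≡ (*-comm (n / 2) 2))
... | 1 | n≡ | _ = n / 2 , inj₂ (trans n≡ (cong suc (*-comm (n / 2) 2)))
... | suc (suc _) | _ | s≤s (s≤s ())

m+n∈[m,m+o] : ∀ {m n o} → n ≤ o → (m + n) ∈[ m , m + o ]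
m+n∈[m,m+o] {m} {n} n≤o = m≤m+n m n , +-monoʳ-≤ m n≤o

∈[m,m+o]⇒∃[n≤o]m+n≡ : ∀ {m o v} → v ∈[ m , m + o ] → ∃ λ n → n ≤ o × m + n ≡ v
∈[m,m+o]⇒∃[n≤o]m+n≡ {m} (m≤v , v≤m+o) with m≤n⇒∃[o]m+o≡n m≤v
... | n , refl = n , +-cancelˡ-≤ m _ _ v≤m+o , refl

interval-cong : ∀ {lo lo′ hi hi′} → lo ≡ lo′ → hi ≡ hi′ → _∈[ lo , hi ] ≐ _∈[ lo′ , hi′ ]
interval-cong refl refl = id , id

All-endpoints⁺ : ∀ {P : Pred ℕ 0ℓ} {M} → All (λ e → P (proj₁ e) × P (proj₂ e)) M → All P (endpoints M)
All-endpoints⁺ [] = []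
All-endpoints⁺ ((pa , pb) ∷ ps) = pa ∷ pb ∷ All-endpoints⁺ ps

∈⇒∈-endpoints : ∀ {a b M} → (a , b) ∈ M → a ∈ endpoints M × b ∈ endpoints M
∈⇒∈-endpoints {M = _ ∷ _} (here refl) = here refl , there (here refl)
∈⇒∈-endpoints {M = _ ∷ _} (there e∈M) with ∈⇒∈-endpoints e∈M
... | a∈ , b∈ = there (there a∈) , there (there b∈)

Apart : Edge → Edge → Set
Apart e e′ = proj₁ e ≢ proj₁ e′ × proj₂ e ≢ proj₂ e′ × colour e ≢ colour e′

endpoints-unique : ∀ {L R : Pred ℕ 0ℓ} {M} → ¬ (L ≬ R) →
  All (λ e → L (proj₁ e) × R (proj₂ e)) M → AllPairs Apart M → Unique (endpoints M)
endpoints-unique {L} {R} L∩R=∅ = go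
  where
  L≢R : ∀ {a b} → L a → R b → a ≢ b
  L≢R La Rb refl = L∩R=∅ (_ , La , Rb)
  go : ∀ {M} → All (λ e → L (proj₁ e) × R (proj₂ e)) M → AllPairs Apart M → Unique (endpoints M)
  go [] [] = []
  go ((La , Rb) ∷ LRs) (aparts ∷ apartss) =
    (L≢R La Rb ∷ All-endpoints⁺ (All.zipWith (λ ((_ , Rb′) , a≢a′ , _) → a≢a′ , L≢R La Rb′)
                                             (LRs , aparts)))
    ∷ All-endpoints⁺ (All.zipWith (λ ((La′ , _) , _ , b≢b′ , _) → ≢-sym (L≢R La′ Rb) , b≢b′)
                                  (LRs , aparts))
    ∷ go LRs apartss

record IsRainbowPerfectMatching (L R C : Pred ℕ 0ℓ) (M : List Edge) : Set where
  field
    joins    : All (λ e → L (proj₁ e) × R (proj₂ e)) M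
    coloured : All (C ∘ colour) M
    disjoint : Unique (endpoints M)
    rainbow  : Rainbow M
    covers   : L ∪ R ⊆ (_∈ endpoints M)

  resp : ∀ {L′ R′ C′} → L ≐ L′ → R ≐ R′ → C ⊆ C′ → IsRainbowPerfectMatching L′ R′ C′ M
  resp (L⊆L′ , L′⊆L) (R⊆R′ , R′⊆R) C⊆C′ = record
    { joins    = All.map (λ (La , Rb) → L⊆L′ La , R⊆R′ Rb) joins
    ; coloured = All.map C⊆C′ coloured
    ; disjoint = disjoint
    ; rainbow  = rainbow
    ; covers   = λ { (inj₁ L′v) → covers (inj₁ (L′⊆L L′v))
                   ; (inj₂ R′v) → covers (inj₂ (R′⊆R R′v)) }
    }

module Staircase (A c m : ℕ) where

  B : ℕ
  B = A + (c + m)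

  low : ℕ → Edge
  low k = A + k , B + 2 * k

  high : ℕ → Edge
  high k = A + suc (m + k) , B + suc (2 * k)

  staircase : List Edge
  staircase = applyUpTo low (suc m) ++ applyUpTo high m

  colour-low : ∀ k → colour (low k) ≡ c + (m + k)
  colour-low k = trans (cong (∣ A + k -_∣) (B+2k≡ A c m k)) (∣m-m+n∣≡n (A + k) _)
    where B+2k≡ : ∀ A c m k → A + (c + m) + 2 * k ≡ A + k + (c + (m + k))
          B+2k≡ = solve-∀

  colour-high : ∀ k → colour (high k) ≡ c + k
  colour-high k =
    trans (cong (∣ A + suc (m + k) -_∣) (B+1+2k≡ A c m k)) (∣m-m+n∣≡n (A + suc (m + k)) _)
    where B+1+2k≡ : ∀ A c m k → A + (c + m) + suc (2 * k) ≡ A + suc (m + k) + (c + k)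
          B+1+2k≡ = solve-∀

  Left Right Colours : Pred ℕ 0ℓ
  Left    = _∈[ A , A + 2 * m ]
  Right   = _∈[ B , B + 2 * m ]
  Colours = _∈[ c , c + 2 * m ]

  InRange : Edge → Set
  InRange e = Left (proj₁ e) × Right (proj₂ e) × Colours (colour e)

  low-in-range : ∀ {k} → k ≤ m → InRange (low k)
  low-in-range {k} k≤m rewrite colour-low k =
    m+n∈[m,m+o] (≤-trans k≤m (m≤m+n m _)) ,
    m+n∈[m,m+o] (*-monoʳ-≤ 2 k≤m) ,
    m+n∈[m,m+o] (+-monoʳ-≤ m (≤-trans k≤m (m≤m+n m 0)))

  high-in-range : ∀ {k} → k < m → InRange (high k)
  high-in-range {k} k<m rewrite colour-high k =
    m+n∈[m,m+o] (+-monoʳ-< m (≤-trans k<m (m≤m+n m 0))) ,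
    m+n∈[m,m+o] (*-monoʳ-< 2 k<m) ,
    m+n∈[m,m+o] (≤-trans (<⇒≤ k<m) (m≤m+n m _))

  staircase-in-range : All InRange staircase
  staircase-in-range = All.++⁺ (All.applyUpTo⁺₁ low (suc m) (low-in-range ∘ s≤s⁻¹))
                              (All.applyUpTo⁺₁ high m high-in-range)

  low-apart : ∀ {i j} → i < j → Apart (low i) (low j)
  low-apart {i} {j} i<j =
    <⇒≢ (+-monoʳ-< A i<j) ,
    <⇒≢ (+-monoʳ-< B (*-monoʳ-< 2 i<j)) ,
    subst₂ _≢_ (sym (colour-low i)) (sym (colour-low j)) (<⇒≢ (+-monoʳ-< c (+-monoʳ-< m i<j)))

  high-apart : ∀ {i j} → i < j → Apart (high i) (high j)
  high-apart {i} {j} i<j =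
    <⇒≢ (+-monoʳ-< A (s<s (+-monoʳ-< m i<j))) ,
    <⇒≢ (+-monoʳ-< B (s<s (*-monoʳ-< 2 i<j))) ,
    subst₂ _≢_ (sym (colour-high i)) (sym (colour-high j)) (<⇒≢ (+-monoʳ-< c i<j))

  low-high-apart : ∀ {i j} → i ≤ m → j < m → Apart (low i) (high j)
  low-high-apart {i} {j} i≤m j<m =
    <⇒≢ (+-monoʳ-< A (s≤s (≤-trans i≤m (m≤m+n m j)))) ,
    even≢odd i j ∘ +-cancelˡ-≡ B _ _ ,
    subst₂ _≢_ (sym (colour-low i)) (sym (colour-high j))
      (≢-sym (<⇒≢ (+-monoʳ-< c (<-≤-trans j<m (m≤m+n m i)))))

  staircase-apart : AllPairs Apart staircase
  staircase-apart = AllPairs.++⁺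
    (AllPairs.applyUpTo⁺₁ low (suc m) (λ i<j _ → low-apart i<j))
    (AllPairs.applyUpTo⁺₁ high m (λ i<j _ → high-apart i<j))
    (All.applyUpTo⁺₁ _ (suc m) λ i≤m → All.applyUpTo⁺₁ _ m (low-high-apart (s≤s⁻¹ i≤m)))

  low∈staircase : ∀ {k} → k ≤ m → low k ∈ staircase
  low∈staircase k≤m = ∈-++⁺ˡ (∈-applyUpTo⁺ low (s≤s k≤m))

  high∈staircase : ∀ {k} → k < m → high k ∈ staircase
  high∈staircase k<m = ∈-++⁺ʳ (applyUpTo low (suc m)) (∈-applyUpTo⁺ high k<m)

  left-covered : ∀ {t} → t ≤ 2 * m → A + t ∈ endpoints staircase
  left-covered {t} t≤2m with t ≤? m
  ... | yes t≤m = proj₁ (∈⇒∈-endpoints (low∈staircase t≤m))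
  ... | no t≰m with m≤n⇒∃[o]m+o≡n (≰⇒> t≰m)
  ...   | k , refl = proj₁ (∈⇒∈-endpoints (high∈staircase k<m))
    where k<m : k < m
          k<m = subst (k <_) (+-identityʳ m) (+-cancelˡ-< m k (m + 0) t≤2m)

  right-covered : ∀ {s} → s ≤ 2 * m → B + s ∈ endpoints staircase
  right-covered {s} s≤2m with even-or-odd s
  ... | h , inj₁ refl = proj₂ (∈⇒∈-endpoints (low∈staircase (*-cancelˡ-≤ {h} {m} 2 s≤2m)))
  ... | h , inj₂ refl = proj₂ (∈⇒∈-endpoints (high∈staircase (*-cancelˡ-< 2 h m s≤2m)))

  covered : Left ∪ Right ⊆ (_∈ endpoints staircase)
  covered (inj₁ v∈Left) with ∈[m,m+o]⇒∃[n≤o]m+n≡ v∈Left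
  ... | _ , t≤2m , refl = left-covered t≤2m
  covered (inj₂ v∈Right) with ∈[m,m+o]⇒∃[n≤o]m+n≡ v∈Right
  ... | _ , s≤2m , refl = right-covered s≤2m

  Left-disjoint-Right : m < c → ¬ (Left ≬ Right)
  Left-disjoint-Right m<c (_ , (_ , v≤A+2m) , (B≤v , _)) = <⇒≱ (≤-<-trans v≤A+2m A+2m<B) B≤v
    where A+2m<B : A + 2 * m < B
          A+2m<B = +-monoʳ-< A (subst (λ x → m + x < c + m) (sym (+-identityʳ m)) (+-monoˡ-< m m<c))

  isRainbowPerfectMatching : m < c → IsRainbowPerfectMatching Left Right Colours staircase
  isRainbowPerfectMatching m<c = record
    { joins    = joins
    ; coloured = All.map (proj₂ ∘ proj₂) staircase-in-range
    ; disjoint = endpoints-unique (Left-disjoint-Right m<c) joins staircase-apart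
    ; rainbow  = AllPairs.map⁺ (AllPairs.map (proj₂ ∘ proj₂) staircase-apart)
    ; covers   = covered
    }
    where joins : All (λ e → Left (proj₁ e) × Right (proj₂ e)) staircase
          joins = All.map (λ (l , r , _) → l , r) staircase-in-range

block-top : ∀ k {ℓ m} → ℓ ≡ suc (2 * m) → k * ℓ + 1 + 2 * m ≡ suc k * ℓ
block-top k {ℓ} {m} ℓ≡1+2m = begin
  k * ℓ + 1 + 2 * m    ≡⟨ +-assoc (k * ℓ) 1 (2 * m) ⟩
  k * ℓ + suc (2 * m)  ≡⟨ +-comm (k * ℓ) (suc (2 * m)) ⟩
  suc (2 * m) + k * ℓ  ≡⟨ cong (_+ k * ℓ) ℓ≡1+2m ⟨
  ℓ + k * ℓ            ∎
  where open ≡-Reasoning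

block-matching : ∀ i j ℓ → ℓ % 2 ≡ 1 → i < j →
  ∃ (IsRainbowPerfectMatching (_∈I[ i , ℓ ]) (_∈I[ j , ℓ ]) (_∈C[ i , j , ℓ ]))
block-matching i j ℓ ℓ-odd i<j =
  staircase , resp (isRainbowPerfectMatching m<c) Left≐Iᵢ Right≐Iⱼ Colours⊆Cᵢⱼ
  where
  m = ℓ / 2
  d = (j ∸ i) * ℓ
  c = d ∸ m
  A = i * ℓ + 1
  open Staircase A c m
  open IsRainbowPerfectMatching using (resp)

  ℓ≡1+2m : ℓ ≡ suc (2 * m)
  ℓ≡1+2m = n%2≡1⇒n≡1+2*[n/2] ℓ-odd

  1+2m≤d : suc (2 * m) ≤ d
  1+2m≤d = subst (_≤ d) (trans (*-identityˡ ℓ) ℓ≡1+2m) (*-monoˡ-≤ ℓ (m<n⇒0<n∸m i<j))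

  m<c : m < c
  m<c = m+n≤o⇒m≤o∸n (suc m) (subst (λ x → suc (m + x) ≤ d) (+-identityʳ m) 1+2m≤d)

  c+m≡d : c + m ≡ d
  c+m≡d = m∸n+n≡m (≤-trans (m/n≤m ℓ 2) (≤-trans (≤-reflexive ℓ≡1+2m) 1+2m≤d))

  B≡jℓ+1 : B ≡ j * ℓ + 1
  B≡jℓ+1 = begin
    i * ℓ + 1 + (c + m)  ≡⟨ cong (i * ℓ + 1 +_) c+m≡d ⟩
    i * ℓ + 1 + d        ≡⟨ xy∙z≈xz∙y +-commutativeSemigroup (i * ℓ) 1 d ⟩
    i * ℓ + d + 1        ≡⟨ cong (_+ 1) (*-distribʳ-+ ℓ i (j ∸ i)) ⟨
    (i + (j ∸ i)) * ℓ + 1 ≡⟨ cong (λ x → x * ℓ + 1) (m+[n∸m]≡n (<⇒≤ i<j)) ⟩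
    j * ℓ + 1            ∎
    where open ≡-Reasoning

  Left≐Iᵢ : Left ≐ _∈I[ i , ℓ ]
  Left≐Iᵢ = interval-cong refl (block-top i {m = m} ℓ≡1+2m)

  Right≐Iⱼ : Right ≐ _∈I[ j , ℓ ]
  Right≐Iⱼ = interval-cong B≡jℓ+1 (trans (cong (_+ 2 * m) B≡jℓ+1) (block-top j {m = m} ℓ≡1+2m))

  Colours⊆Cᵢⱼ : Colours ⊆ _∈C[ i , j , ℓ ]
  Colours⊆Cᵢⱼ =
    proj₁ (interval-cong refl (trans (sym (+-assoc c m (m + 0))) (cong₂ _+_ c+m≡d (+-identityʳ m))))

edge-between-blocks : ∀ {i j ℓ n a b} → i < j → suc j * ℓ ≤ n →
  a ∈I[ i , ℓ ] → b ∈I[ j , ℓ ] → IsEdgeOf n (a , b)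
edge-between-blocks {i} {j} {ℓ} {n} {a} {b} i<j Iⱼ≤n (a-lo , a-hi) (b-lo , b-hi) =
  (≤-trans (m≤n+m 1 (i * ℓ)) a-lo , ≤-trans (<⇒≤ a<b) b≤n) ,
  (≤-trans (m≤n+m 1 (j * ℓ)) b-lo , b≤n) ,
  <⇒≢ a<b
  where
  a<b : a < b
  a<b = ≤-<-trans (≤-trans a-hi (*-monoˡ-≤ ℓ i<j)) (<-≤-trans (m<m+n (j * ℓ) z<s) b-lo)
  b≤n : b ≤ n
  b≤n = ≤-trans b-hi Iⱼ≤n

proposition5p6 : (i j ℓ n : ℕ) → ℓ % 2 ≡ 1 → i < j → suc j * ℓ ≤ n →
    ∃ λ M → RainbowPerfectMatchingBetween n i j ℓ M
proposition5p6 i j ℓ n ℓ-odd i<j Iⱼ≤n with block-matching i j ℓ ℓ-odd i<j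
... | M , isRPM =
  M , (All.map edge joins , disjoint) , rainbow , All.map inj₁ joins , (λ _ → covers) , coloured
  where
  open IsRainbowPerfectMatching isRPM
  edge : ∀ {e} → proj₁ e ∈I[ i , ℓ ] × proj₂ e ∈I[ j , ℓ ] → IsEdgeOf n e
  edge (a∈Iᵢ , b∈Iⱼ) = edge-between-blocks i<j Iⱼ≤n a∈Iᵢ b∈Iⱼ
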